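{- Let $\operatorname{nz}(N)$ denote the number of indices $i$ with $1\le i\le N$ such that $a_i=1$, where $\sqrt{2}=\sum_{i} a_i 2^{ -i}$ is the binary expansion of $\sqrt{2}$ with digits $a_i\in\{0,1\}$. Then, as $N\to\infty$, \[ \operatorname{nz}(N)\ge \sqrt{2}\,N^{1/2}(1+o(1)). \]
   Context: The binary expansion $\sqrt{2}=\sum_i a_i2^{ -i}$ with $a_i\in\{0,1\}$; $\operatorname{nz}(N)$ counts the nonzero digits among the first $N$ binary digits after the binary point. The notation $f(N)=o(g(N))$ means $f(N)/g(N)\to 0$ as $N\to\infty$; thus the claim means $\liminf_{N\to\infty}\operatorname{nz}(N)/\sqrt{N}\ge\sqrt{2}$. -}

module Defs where

open import Data.Nat using (ℕ; zero; suc; _+_; _*_; _^_; _≤?_; _%_)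
open import Relation.Nullary using (yes; no)

isqrt : ℕ → ℕ
isqrt zero = zero
isqrt (suc n) with suc (isqrt n) * suc (isqrt n) ≤? suc n
... | yes _ = suc (isqrt n)
... | no  _ = isqrt n

floor2^i√2 : ℕ → ℕ
floor2^i√2 i = isqrt (2 * 4 ^ i)

-- a_i : the i-th binary digit of √2 after the binary point (i ≥ 1),
-- a_i = ⌊2^i √2⌋ mod 2.  (For i = 0 this gives the integer part 1.)
digit : ℕ → ℕ
digit i = floor2^i√2 i % 2

-- nz N = #{ i : 1 ≤ i ≤ N, a_i = 1 } = Σ_{i=1}^{N} a_i  (digits are 0 or 1)
nz : ℕ → ℕ
nz zero = zero
nz (suc N) = nz N + digit (suc N)

module Submission where

-- Let x = ⌊2^N √2⌋; in binary x = 1.a₁a₂…a_N, so x has k = nz N + 1 ones.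
-- Since √2 is irrational, x² = 2^(2N+1) − d with 1 ≤ d ≤ 2x ≤ 2^(N+2).
-- A number 2^M − d with 1 ≤ d ≤ 2^j has all its bits in positions
-- j, …, M−1 equal to 1, so x² has at least (2N+1) − (N+2) = N − 1 ones.
-- On the other hand, squaring by shift-and-add shows that a number with k
-- ones has a square with at most k(k+1)/2 ones.  Together:
--   2N ≤ (nz N + 1)(nz N + 2) + 2,
-- which gives nz N ≥ (√2 − ε)√N for large N, the statement theorem1.

open import Defs
open import Data.Bool using (Bool; true; false)
open import Data.Empty using (⊥-elim)
open import Data.List using (List; []; _∷_)
open import Data.Nat
open import Data.Nat.DivMod using (m≡m%n+[m/n]*n; m%n<n; m/n*n≤m)
open import Data.Nat.Properties
open import Data.Nat.Tactic.RingSolver using (solve-∀)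
open import Data.Product using (∃-syntax; _,_; _×_; proj₁; proj₂)
open import Data.Sum using (_⊎_; inj₁; inj₂)
open import Relation.Binary.PropositionalEquality
open import Relation.Nullary using (yes; no)

root-below : ∀ {a b n} → a * a ≤ n → n < suc b * suc b → a ≤ b
root-below a²≤n n<[b+1]² =
  ≮⇒≥ λ b<a → <⇒≱ n<[b+1]² (≤-trans (*-mono-≤ b<a b<a) a²≤n)

isqrt-spec : ∀ n → isqrt n * isqrt n ≤ n × n < suc (isqrt n) * suc (isqrt n)
isqrt-spec zero = z≤n , s≤s z≤n
isqrt-spec (suc n) with suc (isqrt n) * suc (isqrt n) ≤? suc n
... | yes r²≤n = r²≤n , ≤-<-trans (proj₂ (isqrt-spec n)) (*-mono-< (n<1+n (suc (isqrt n))) (n<1+n (suc (isqrt n))))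
... | no  r²≰n = m≤n⇒m≤1+n (proj₁ (isqrt-spec n)) , ≰⇒> r²≰n

isqrt-unique : ∀ n t → t * t ≤ n → n < suc t * suc t → isqrt n ≡ t
isqrt-unique n t t²≤n n<[t+1]² =
  ≤-antisym (root-below (proj₁ (isqrt-spec n)) n<[t+1]²)
            (root-below t²≤n (proj₂ (isqrt-spec n)))

four-times-square : ∀ a → 4 * (a * a) ≡ 2 * a * (2 * a)
four-times-square = solve-∀

-- ⌊√(4m)⌋ is 2⌊√m⌋ or 2⌊√m⌋ + 1: halving it gives ⌊√m⌋.
isqrt-quarter : ∀ m → isqrt (4 * m) / 2 ≡ isqrt m
isqrt-quarter m = sym (isqrt-unique m s lower upper)
  where
  t s : ℕ
  t = isqrt (4 * m)
  s = t / 2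
  2s≤t : 2 * s ≤ t
  2s≤t = ≤-trans (≤-reflexive (*-comm 2 s)) (m/n*n≤m t 2)
  t<2s+2 : t < 2 * suc s
  t<2s+2 = subst (_< 2 * suc s) (sym (trans (m≡m%n+[m/n]*n t 2) (cong (t % 2 +_) (*-comm s 2))))
             (subst (t % 2 + 2 * s <_) (sym (*-suc 2 s)) (+-monoˡ-< (2 * s) (m%n<n t 2)))
  lower : s * s ≤ m
  lower = *-cancelˡ-≤ 4 (begin
    4 * (s * s)     ≡⟨ four-times-square s ⟩
    2 * s * (2 * s) ≤⟨ *-mono-≤ 2s≤t 2s≤t ⟩
    t * t           ≤⟨ proj₁ (isqrt-spec (4 * m)) ⟩
    4 * m           ∎)
    where open ≤-Reasoning
  upper : m < suc s * suc s
  upper = *-cancelˡ-< 4 m (suc s * suc s) (begin-strict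
    4 * m                       <⟨ proj₂ (isqrt-spec (4 * m)) ⟩
    suc t * suc t               ≤⟨ *-mono-≤ t<2s+2 t<2s+2 ⟩
    2 * suc s * (2 * suc s)     ≡⟨ four-times-square (suc s) ⟨
    4 * (suc s * suc s)         ∎)
    where open ≤-Reasoning

double-4^-suc : ∀ i → 2 * 4 ^ suc i ≡ 4 * (2 * 4 ^ i)
double-4^-suc i = lemma (4 ^ i)
  where
  lemma : ∀ a → 2 * (4 * a) ≡ 4 * (2 * a)
  lemma = solve-∀

4^-square : ∀ n → 4 ^ n ≡ 2 ^ n * 2 ^ n
4^-square zero = refl
4^-square (suc n) = trans (cong (4 *_) (4^-square n)) (four-times-square (2 ^ n))

2^-reflects-≤ : ∀ {m n} → 2 ^ m ≤ 2 ^ n → m ≤ n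
2^-reflects-≤ 2^m≤2^n = ≮⇒≥ λ n<m → <⇒≱ (^-monoʳ-< 2 (s≤s (s≤s z≤n)) n<m) 2^m≤2^n

floor-step : ∀ i → floor2^i√2 (suc i) ≡ digit (suc i) + 2 * floor2^i√2 i
floor-step i = begin
  x′                          ≡⟨ m≡m%n+[m/n]*n x′ 2 ⟩
  digit (suc i) + x′ / 2 * 2  ≡⟨ cong (λ h → digit (suc i) + h * 2) halved ⟩
  digit (suc i) + x * 2       ≡⟨ cong (digit (suc i) +_) (*-comm x 2) ⟩
  digit (suc i) + 2 * x       ∎
  where
  open ≡-Reasoning
  x x′ : ℕ
  x  = floor2^i√2 i
  x′ = floor2^i√2 (suc i)
  halved : x′ / 2 ≡ x
  halved = trans (cong (λ n → isqrt n / 2) (double-4^-suc i)) (isqrt-quarter (2 * 4 ^ i))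

even-or-odd : ∀ n → ∃[ h ] (n ≡ 2 * h ⊎ n ≡ suc (2 * h))
even-or-odd zero = 0 , inj₁ refl
even-or-odd (suc n) with even-or-odd n
... | h , inj₁ n≡2h  = h , inj₂ (cong suc n≡2h)
... | h , inj₂ n≡2h+1 = suc h , inj₁ (trans (cong suc n≡2h+1) (sym (*-suc 2 h)))

not-square : ∀ N x → x * x ≢ 2 * 4 ^ N
not-square zero 0 ()
not-square zero 1 ()
not-square zero (suc (suc y)) x²≡2 =
  <⇒≱ (s≤s (s≤s (s≤s z≤n))) (subst (4 ≤_) x²≡2 (*-mono-≤ {2} {suc (suc y)} 2≤ 2≤))
  where
  2≤ : 2 ≤ suc (suc y)
  2≤ = s≤s (s≤s z≤n)
not-square (suc N) x x²≡T with even-or-odd x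
... | h , inj₁ refl = not-square N h (*-cancelˡ-≡ (h * h) (2 * 4 ^ N) 4 (begin
    4 * (h * h)       ≡⟨ four-times-square h ⟩
    2 * h * (2 * h)   ≡⟨ x²≡T ⟩
    2 * 4 ^ suc N     ≡⟨ double-4^-suc N ⟩
    4 * (2 * 4 ^ N)   ∎))
  where open ≡-Reasoning
... | h , inj₂ refl = even≢odd (4 ^ suc N) (2 * (h * h) + 2 * h) (begin
    2 * 4 ^ suc N                         ≡⟨ x²≡T ⟨
    suc (2 * h) * suc (2 * h)             ≡⟨ odd-square h ⟩
    suc (2 * (2 * (h * h) + 2 * h))       ∎)
  where
  open ≡-Reasoning
  odd-square : ∀ h → suc (2 * h) * suc (2 * h) ≡ suc (2 * (2 * (h * h) + 2 * h))
  odd-square = solve-∀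

-- The square deficit: x = ⌊2^N√2⌋ satisfies x² + d = 2^(2N+1) with
-- 1 ≤ d ≤ 2^(N+2) (d ≥ 1 by irrationality, d ≤ 2x since (x+1)² > 2^(2N+1)).
square-deficit : ∀ N → ∃[ d ] (floor2^i√2 N * floor2^i√2 N + d ≡ 2 ^ suc (N + N)
                               × 1 ≤ d × d ≤ 2 ^ suc (suc N))
square-deficit N = T ∸ x * x , total , positive , small
  where
  open ≤-Reasoning
  T x b : ℕ
  T = 2 * 4 ^ N
  x = floor2^i√2 N
  b = 2 ^ suc N
  below : x * x ≤ T
  below = proj₁ (isqrt-spec T)
  filled : x * x + (T ∸ x * x) ≡ T
  filled = m+[n∸m]≡n below
  total : x * x + (T ∸ x * x) ≡ 2 ^ suc (N + N)
  total = trans filled (cong (2 *_) (trans (4^-square N) (sym (^-distribˡ-+-* 2 N N))))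
  positive : 1 ≤ T ∸ x * x
  positive = m<n⇒0<n∸m (≤∧≢⇒< below (not-square N x))
  next-square : ∀ x → suc x * suc x ≡ x * x + suc (2 * x)
  next-square = solve-∀
  d≤2x : T ∸ x * x ≤ 2 * x
  d≤2x = ≤-pred (+-cancelˡ-< (x * x) _ _ (begin-strict
    x * x + (T ∸ x * x)  ≡⟨ filled ⟩
    T                    <⟨ proj₂ (isqrt-spec T) ⟩
    suc x * suc x        ≡⟨ next-square x ⟩
    x * x + suc (2 * x)  ∎))
  x≤b : x ≤ b
  x≤b = root-below below (begin-strict
    T              ≤⟨ *-monoˡ-≤ (4 ^ N) {2} {4} (s≤s (s≤s z≤n)) ⟩
    4 ^ suc N      ≡⟨ 4^-square (suc N) ⟩
    b * b          <⟨ *-mono-< (n<1+n b) (n<1+n b) ⟩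
    suc b * suc b  ∎)
  small : T ∸ x * x ≤ 2 ^ suc (suc N)
  small = ≤-trans d≤2x (*-monoʳ-≤ 2 x≤b)

-- Binary words, least significant bit first.
Word : Set
Word = List Bool

bitValue : Bool → ℕ
bitValue true  = 1
bitValue false = 0

bitValue≤1 : ∀ b → bitValue b ≤ 1
bitValue≤1 true  = s≤s z≤n
bitValue≤1 false = z≤n

value : Word → ℕ
value []      = 0
value (b ∷ w) = bitValue b + 2 * value w

weight : Word → ℕ
weight []      = 0
weight (b ∷ w) = bitValue b + weight w

inc : Word → Word
inc []          = true ∷ []
inc (false ∷ w) = true ∷ w
inc (true ∷ w)  = false ∷ inc w

inc-value : ∀ w → value (inc w) ≡ suc (value w)
inc-value []          = refl
inc-value (false ∷ w) = refl
inc-value (true ∷ w)  = trans (cong (2 *_) (inc-value w)) (*-suc 2 (value w))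

inc-weight : ∀ w → weight (inc w) ≤ suc (weight w)
inc-weight []          = ≤-refl
inc-weight (false ∷ w) = ≤-refl
inc-weight (true ∷ w)  = ≤-trans (inc-weight w) (n≤1+n _)

add : Word → Word → Word
add u           []          = u
add []          (b ∷ v)     = b ∷ v
add (a ∷ u)     (false ∷ v) = a ∷ add u v
add (false ∷ u) (true ∷ v)  = true ∷ add u v
add (true ∷ u)  (true ∷ v)  = false ∷ inc (add u v)

add-value : ∀ u v → value (add u v) ≡ value u + value v
add-value u [] = sym (+-identityʳ (value u))
add-value [] (b ∷ v) = refl
add-value (a ∷ u) (false ∷ v) =
  trans (cong (λ s → bitValue a + 2 * s) (add-value u v)) (no-carry (bitValue a) (value u) (value v))
  where
  no-carry : ∀ a u v → a + 2 * (u + v) ≡ a + 2 * u + (0 + 2 * v)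
  no-carry = solve-∀
add-value (false ∷ u) (true ∷ v) =
  trans (cong (λ s → 1 + 2 * s) (add-value u v)) (one-bit (value u) (value v))
  where
  one-bit : ∀ u v → 1 + 2 * (u + v) ≡ 0 + 2 * u + (1 + 2 * v)
  one-bit = solve-∀
add-value (true ∷ u) (true ∷ v) =
  trans (cong (2 *_) (trans (inc-value (add u v)) (cong suc (add-value u v))))
        (carry (value u) (value v))
  where
  carry : ∀ u v → 2 * suc (u + v) ≡ 1 + 2 * u + (1 + 2 * v)
  carry = solve-∀

add-weight : ∀ u v → weight (add u v) ≤ weight u + weight v
add-weight u [] = m≤m+n (weight u) 0
add-weight [] (b ∷ v) = ≤-refl
add-weight (a ∷ u) (false ∷ v) =
  ≤-trans (+-monoʳ-≤ (bitValue a) (add-weight u v)) (≤-reflexive (sym (+-assoc (bitValue a) _ _)))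
add-weight (false ∷ u) (true ∷ v) =
  ≤-trans (s≤s (add-weight u v)) (≤-reflexive (sym (+-suc (weight u) (weight v))))
add-weight (true ∷ u) (true ∷ v) = begin
  weight (inc (add u v))           ≤⟨ inc-weight (add u v) ⟩
  suc (weight (add u v))           ≤⟨ s≤s (add-weight u v) ⟩
  suc (weight u + weight v)        ≤⟨ n≤1+n _ ⟩
  suc (suc (weight u + weight v))  ≡⟨ cong suc (+-suc (weight u) (weight v)) ⟨
  suc (weight u + suc (weight v))  ∎
  where open ≤-Reasoning

-- Squaring by shift-and-add: (2u)² = 4u², (2u+1)² = 1 + 4(u² + u).
square : Word → Word
square []          = []
square (false ∷ u) = false ∷ false ∷ square u
square (true ∷ u)  = true ∷ false ∷ add (square u) u

square-value : ∀ u → value (square u) ≡ value u * value u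
square-value [] = refl
square-value (false ∷ u) =
  trans (cong (λ s → 2 * (2 * s)) (square-value u)) (even (value u))
  where
  even : ∀ u → 2 * (0 + 2 * (u * u)) ≡ (0 + 2 * u) * (0 + 2 * u)
  even = solve-∀
square-value (true ∷ u) =
  trans (cong (λ s → 1 + 2 * (2 * s)) (trans (add-value (square u) u)
                                             (cong (_+ value u) (square-value u))))
        (odd (value u))
  where
  odd : ∀ u → 1 + 2 * (2 * (u * u + u)) ≡ (1 + 2 * u) * (1 + 2 * u)
  odd = solve-∀

square-weight : ∀ u → 2 * weight (square u) ≤ weight u * suc (weight u)
square-weight [] = z≤n
square-weight (false ∷ u) = square-weight u
square-weight (true ∷ u) = begin
  2 * suc (weight (add (square u) u))   ≤⟨ *-monoʳ-≤ 2 (s≤s (add-weight (square u) u)) ⟩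
  2 * suc (s + k)                       ≡⟨ split s k ⟩
  2 * s + 2 * suc k                     ≤⟨ +-monoˡ-≤ (2 * suc k) (square-weight u) ⟩
  k * suc k + 2 * suc k                 ≡⟨ triangle k ⟩
  suc k * suc (suc k)                   ∎
  where
  open ≤-Reasoning
  s k : ℕ
  s = weight (square u)
  k = weight u
  split : ∀ s k → 2 * suc (s + k) ≡ 2 * s + 2 * suc k
  split = solve-∀
  triangle : ∀ k → k * suc k + 2 * suc k ≡ suc k * suc (suc k)
  triangle = solve-∀

-- Halving  c + 2v + d = 2P  (c a bit, 1 ≤ d ≤ 2Q) moves the deficit up one
-- position: v + e = P with 1 ≤ e ≤ Q and c + d = 2e.
halve : ∀ {c v d P Q} → c ≤ 1 → 1 ≤ d → d ≤ 2 * Q → c + 2 * v + d ≡ 2 * P →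
        ∃[ e ] (v + e ≡ P × 1 ≤ e × e ≤ Q × c + d ≡ 2 * e)
halve {c} {v} {d} {P} {Q} c≤1 1≤d d≤2Q eq = P ∸ v , m+[n∸m]≡n v≤P , e-positive , e-bound , twice
  where
  rearrange : ∀ c v d → c + d + 2 * v ≡ c + 2 * v + d
  rearrange = solve-∀
  v≤P : v ≤ P
  v≤P = *-cancelˡ-≤ 2 (≤-trans (m≤n+m (2 * v) c) (≤-trans (m≤m+n (c + 2 * v) d) (≤-reflexive eq)))
  twice : c + d ≡ 2 * (P ∸ v)
  twice = begin
    c + d                  ≡⟨ m+n∸n≡m (c + d) (2 * v) ⟨
    c + d + 2 * v ∸ 2 * v  ≡⟨ cong (_∸ 2 * v) (trans (rearrange c v d) eq) ⟩
    2 * P ∸ 2 * v          ≡⟨ *-distribˡ-∸ 2 P v ⟨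
    2 * (P ∸ v)            ∎
    where open ≡-Reasoning
  e-positive : 1 ≤ P ∸ v
  e-positive = *-cancelˡ-< 2 0 (P ∸ v) (≤-trans 1≤d (≤-trans (m≤n+m d c) (≤-reflexive twice)))
  e-bound : P ∸ v ≤ Q
  e-bound = ≤-pred (*-cancelˡ-< 2 (P ∸ v) (suc Q) (begin-strict
    2 * (P ∸ v)   ≡⟨ twice ⟨
    c + d         ≤⟨ +-mono-≤ c≤1 d≤2Q ⟩
    1 + 2 * Q     <⟨ n<1+n _ ⟩
    2 + 2 * Q     ≡⟨ *-suc 2 Q ⟨
    2 * suc Q     ∎))
    where open ≤-Reasoning

-- If value w = 2^M − d with 1 ≤ d ≤ 2^j, then the bits of w in positions
-- j, …, M−1 are all 1, so w has at least M − j ones.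
weight-below-power : ∀ w M j d → value w + d ≡ 2 ^ M → 1 ≤ d → d ≤ 2 ^ j → M ≤ weight w + j
weight-below-power w zero j d _ _ _ = z≤n
weight-below-power [] (suc M) j d eq _ d≤2^j = 2^-reflects-≤ (subst (_≤ 2 ^ j) eq d≤2^j)
weight-below-power (false ∷ w) (suc M) zero d eq 1≤d d≤1
  with halve {v = value w} {P = 2 ^ M} {Q = 1} z≤n 1≤d (m≤n⇒m≤1+n d≤1) eq
... | e , _ , 1≤e , _ , d≡2e =
  ⊥-elim (1+n≰n (≤-trans (≤-trans (*-monoʳ-≤ 2 1≤e) (≤-reflexive (sym d≡2e))) d≤1))
weight-below-power (true ∷ w) (suc M) zero d eq 1≤d d≤1
  with halve {v = value w} {P = 2 ^ M} {Q = 1} (s≤s z≤n) 1≤d (m≤n⇒m≤1+n d≤1) eq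
... | e , eq′ , 1≤e , e≤1 , _ = s≤s (weight-below-power w M zero e eq′ 1≤e e≤1)
weight-below-power (b ∷ w) (suc M) (suc j) d eq 1≤d d≤2^j+1
  with halve {v = value w} {P = 2 ^ M} {Q = 2 ^ j} (bitValue≤1 b) 1≤d d≤2^j+1 eq
... | e , eq′ , 1≤e , e≤2^j , _ = begin
  suc M                      ≤⟨ s≤s (weight-below-power w M j e eq′ 1≤e e≤2^j) ⟩
  suc (weight w + j)         ≡⟨ +-suc (weight w) j ⟨
  weight w + suc j           ≤⟨ +-monoˡ-≤ (suc j) (m≤n+m (weight w) (bitValue b)) ⟩
  bitValue b + weight w + suc j ∎
  where open ≤-Reasoning

toBit : ℕ → Bool
toBit zero    = false
toBit (suc _) = true

bitValue-toBit : ∀ {d} → d < 2 → bitValue (toBit d) ≡ d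
bitValue-toBit {0} _ = refl
bitValue-toBit {1} _ = refl
bitValue-toBit {suc (suc _)} (s≤s (s≤s ()))

digit<2 : ∀ i → digit i < 2
digit<2 i = m%n<n (floor2^i√2 i) 2

-- The word a_N … a₂ a₁ 1 (least significant bit first), i.e. 1.a₁…a_N.
expansion : ℕ → Word
expansion zero    = true ∷ []
expansion (suc N) = toBit (digit (suc N)) ∷ expansion N

expansion-value : ∀ N → value (expansion N) ≡ floor2^i√2 N
expansion-value zero = refl
expansion-value (suc N) =
  trans (cong₂ (λ a v → a + 2 * v) (bitValue-toBit (digit<2 (suc N))) (expansion-value N))
        (sym (floor-step N))

expansion-weight : ∀ N → weight (expansion N) ≡ suc (nz N)
expansion-weight zero = refl
expansion-weight (suc N) =
  trans (cong₂ _+_ (bitValue-toBit (digit<2 (suc N))) (expansion-weight N))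
        (+-comm (digit (suc N)) (suc (nz N)))

many-ones-in-square : ∀ N → N ≤ weight (square (expansion N)) + 1
many-ones-in-square N with square-deficit N
... | d , total , 1≤d , d≤2^[N+2] = +-cancelʳ-≤ N N (W + 1) (≤-pred (begin
    suc (N + N)      ≤⟨ weight-below-power w (suc (N + N)) (suc (suc N)) d total′ 1≤d d≤2^[N+2] ⟩
    W + suc (suc N)  ≡⟨ shift W N ⟩
    suc (W + 1 + N)  ∎))
  where
  open ≤-Reasoning
  w : Word
  w = square (expansion N)
  W : ℕ
  W = weight w
  total′ : value w + d ≡ 2 ^ suc (N + N)
  total′ = trans (cong (_+ d) (trans (square-value (expansion N))
                                     (cong (λ y → y * y) (expansion-value N)))) total
  shift : ∀ W N → W + suc (suc N) ≡ suc (W + 1 + N)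
  shift = solve-∀

nz-bound : ∀ N → 2 * N ≤ suc (nz N) * suc (suc (nz N)) + 2
nz-bound N = begin
  2 * N                       ≤⟨ *-monoʳ-≤ 2 (many-ones-in-square N) ⟩
  2 * (W + 1)                 ≡⟨ *-distribˡ-+ 2 W 1 ⟩
  2 * W + 2                   ≤⟨ +-monoˡ-≤ 2 (square-weight (expansion N)) ⟩
  k * suc k + 2               ≡⟨ cong (λ k → k * suc k + 2) (expansion-weight N) ⟩
  suc (nz N) * suc (suc (nz N)) + 2 ∎
  where
  open ≤-Reasoning
  W k : ℕ
  W = weight (square (expansion N))
  k = weight (expansion N)

nz-grows : ∀ B N → B * suc B + 2 < 2 * N → B ≤ nz N
nz-grows B N large = ≮⇒≥ λ nz<B →
  <⇒≱ large (≤-trans (nz-bound N) (+-monoˡ-≤ 2 (*-mono-≤ nz<B (s≤s nz<B))))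

eventual-ratio : ∀ {P Q N n} → P < 2 * Q → 2 * N ≤ suc n * suc (suc n) + 2 → 7 * P < n →
                 P * N ≤ Q * (n * n)
eventual-ratio {P} {Q} {N} {n} P<2Q growth large = *-cancelˡ-≤ 2 (begin
  2 * (P * N)                    ≡⟨ swap P N ⟩
  P * (2 * N)                    ≤⟨ *-monoʳ-≤ P growth ⟩
  P * (suc n * suc (suc n) + 2)  ≡⟨ expand P n ⟩
  P * (n * n) + P * (3 * n + 4)  ≤⟨ +-monoʳ-≤ (P * (n * n)) lower-order ⟩
  P * (n * n) + n * n            ≡⟨ +-comm (P * (n * n)) (n * n) ⟩
  suc P * (n * n)                ≤⟨ *-monoˡ-≤ (n * n) P<2Q ⟩
  2 * Q * (n * n)                ≡⟨ *-assoc 2 Q (n * n) ⟩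
  2 * (Q * (n * n))              ∎)
  where
  open ≤-Reasoning
  swap : ∀ P N → 2 * (P * N) ≡ P * (2 * N)
  swap = solve-∀
  expand : ∀ P n → P * (suc n * suc (suc n) + 2) ≡ P * (n * n) + P * (3 * n + 4)
  expand = solve-∀
  collect : ∀ P n → P * (3 * n + 4 * n) ≡ 7 * P * n
  collect = solve-∀
  lower-order : P * (3 * n + 4) ≤ n * n
  lower-order = begin
    P * (3 * n + 4)      ≤⟨ *-monoʳ-≤ P (+-monoʳ-≤ (3 * n) (*-monoʳ-≤ 4 (≤-trans (s≤s z≤n) large))) ⟩
    P * (3 * n + 4 * n)  ≡⟨ collect P n ⟩
    7 * P * n            ≤⟨ *-monoˡ-≤ n (<⇒≤ large) ⟩
    n * n                ∎

-- The theorem: liminf nz(N)/√N ≥ √2, i.e. for p/q < √2 eventually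
-- p²·N ≤ q²·nz(N)².

theorem1 : (p q : ℕ) → .{{_ : NonZero q}} → p ^ 2 < 2 * q ^ 2 →
    ∃[ N₀ ] ((N : ℕ) → N₀ ≤ N → p ^ 2 * N ≤ q ^ 2 * nz N ^ 2)
theorem1 p q p²<2q² = N₀ , eventually
  where
  B N₀ : ℕ
  B  = suc (7 * p ^ 2)
  N₀ = suc (B * suc B + 2)
  eventually : (N : ℕ) → N₀ ≤ N → p ^ 2 * N ≤ q ^ 2 * nz N ^ 2
  eventually N N₀≤N =
    subst (λ s → p ^ 2 * N ≤ q ^ 2 * s) (cong (nz N *_) (sym (*-identityʳ (nz N))))
      (eventual-ratio {Q = q ^ 2} p²<2q² (nz-bound N) (nz-grows B N (≤-trans N₀≤N (m≤m+n N (N + 0)))))
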